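{- Let $(\mathbf{C},\mathcal M)$ be an $\mathcal M$-adhesive category such that the plain system has initial transformation pairs for conflicts. Let $p_1,p_2$ be plain rules and let $\mathcal S$ be the set of initial conflicts for $\langle p_1,p_2\rangle$, taken up to isomorphism. Then $\mathcal S$ is minimally complete with respect to parallel dependence: there is no set $\mathcal S'$ of conflicts for $\langle p_1,p_2\rangle$ of strictly smaller cardinality than $\mathcal S$ which is complete with respect to parallel dependence.
   Context: An $\mathcal M$-adhesive category is a category with a distinguished class $\mathcal M$ of monomorphisms satisfying the standard axioms (including the van Kampen property). A plain rule $p=(L\leftarrow I\rightarrow R)$ has both morphisms in $\mathcal M$. A plain direct transformation $G\Rightarrow_{p,m}H$ with match $m\colon L\to G$ is a double pushout diagram with intermediate object $D$, $k\colon D\to G$. A pair $H_1\Leftarrow_{p_1,m_1}G\Rightarrow_{p_2,m_2}H_2$ (with $k_i\colon D_i\to G$) is parallel independent if there exist $d_{12}\colon L_1\to D_2$ with $k_2\circ d_{12}=m_1$ and $d_{21}\colon L_2\to D_1$ with $k_1\circ d_{21}=m_2$; otherwise it is parallel dependent, also called a conflict. A pair $tp'\colon P_1\Leftarrow_{p_1,o_1}K\Rightarrow_{p_2,o_2}P_2$ can be embedded into $tp\colon H_1\Leftarrow_{p_1,m_1}G\Rightarrow_{p_2,m_2}H_2$ via extension morphism $f\colon K\to G$ if $m_j=f\circ o_j$ and for each $j$ there are morphisms between intermediate and result objects making all squares between the two double pushout diagrams commute and be pushouts (extension diagrams). Initial transformation pair: $tp^I$ is initial for $tp$ if $tp^I$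 embeds into $tp$ via some $f^I$, and for every $tp'$ embedding into $tp$ via $f$ there are unique extension diagrams embedding $tp^I$ into $tp'$ via a unique $f'^I$ with $f\circ f'^I=f^I$. The system has initial transformation pairs for conflicts if every conflicting plain pair has an initial transformation pair. An initial conflict is a conflicting pair isomorphic to its own initial transformation pair. A set $\mathcal S$ of transformation pairs for $\langle p_1,p_2\rangle$ is complete w.r.t. parallel dependence if every parallel dependent pair $H_1\Leftarrow_{p_1,m_1}G\Rightarrow_{p_2,m_2}H_2$ admits an element of $\mathcal S$ that can be embedded into it via some extension morphism. -}

module Defs where

open import Level using (Level; _⊔_) renaming (suc to lsuc)
open import Data.Product using (Σ; Σ-syntax; _×_; _,_; proj₁; proj₂)
open import Relation.Binary.PropositionalEquality using (_≡_)
open import Relation.Nullary using (¬_)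

record Category (o ℓ : Level) : Set (lsuc (o ⊔ ℓ)) where
  infixr 9 _∘_
  field
    Obj : Set o
    _⇒_ : Obj → Obj → Set ℓ
    id  : ∀ {A} → A ⇒ A
    _∘_ : ∀ {A B C} → B ⇒ C → A ⇒ B → A ⇒ C
    assoc     : ∀ {A B C D} (f : A ⇒ B) (g : B ⇒ C) (h : C ⇒ D) →
                (h ∘ g) ∘ f ≡ h ∘ (g ∘ f)
    identityˡ : ∀ {A B} (f : A ⇒ B) → id ∘ f ≡ f
    identityʳ : ∀ {A B} (f : A ⇒ B) → f ∘ id ≡ f

module CatDefs {o ℓ : Level} (C : Category o ℓ) where
  open Category C

  Monic : ∀ {A B} → A ⇒ B → Set (o ⊔ ℓ)
  Monic {A} f = ∀ {X} (g h : X ⇒ A) → f ∘ g ≡ f ∘ h → g ≡ h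

  Iso : ∀ {A B} → A ⇒ B → Set ℓ
  Iso {A} {B} f = Σ[ g ∈ B ⇒ A ] (g ∘ f ≡ id × f ∘ g ≡ id)

  IsPushout : ∀ {A B C D} (f : A ⇒ B) (g : A ⇒ C) (g' : B ⇒ D) (f' : C ⇒ D) →
              Set (o ⊔ ℓ)
  IsPushout {A} {B} {C} {D} f g g' f' =
    (g' ∘ f ≡ f' ∘ g) ×
    (∀ {X} (h : B ⇒ X) (k : C ⇒ X) → h ∘ f ≡ k ∘ g →
       Σ[ u ∈ D ⇒ X ] ((u ∘ g' ≡ h × u ∘ f' ≡ k) ×
                       (∀ (u' : D ⇒ X) → u' ∘ g' ≡ h → u' ∘ f' ≡ k → u' ≡ u)))

  IsPullback : ∀ {A B C D} (g' : B ⇒ D) (f' : C ⇒ D) (f : A ⇒ B) (g : A ⇒ C) →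
               Set (o ⊔ ℓ)
  IsPullback {A} {B} {C} {D} g' f' f g =
    (g' ∘ f ≡ f' ∘ g) ×
    (∀ {X} (h : X ⇒ B) (k : X ⇒ C) → g' ∘ h ≡ f' ∘ k →
       Σ[ u ∈ X ⇒ A ] ((f ∘ u ≡ h × g ∘ u ≡ k) ×
                       (∀ (u' : X ⇒ A) → f ∘ u' ≡ h → g ∘ u' ≡ k → u' ≡ u)))

record MAdhesive {o ℓ : Level} (C : Category o ℓ) (m : Level) : Set (lsuc (o ⊔ ℓ ⊔ m)) where
  open Category C
  open CatDefs C
  field
    M : ∀ {A B} → A ⇒ B → Set m
    M-monic  : ∀ {A B} {f : A ⇒ B} → M f → Monic f
    M-iso    : ∀ {A B} {f : A ⇒ B} → Iso f → M f
    M-comp   : ∀ {A B C} {f : A ⇒ B} {g : B ⇒ C} → M f → M g → M (g ∘ f)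
    M-decomp : ∀ {A B C} {f : A ⇒ B} {g : B ⇒ C} → M (g ∘ f) → M g → M f
    pushout-along-M : ∀ {A B C} (m : A ⇒ B) (f : A ⇒ C) → M m →
      Σ[ D ∈ Obj ] Σ[ g ∈ B ⇒ D ] Σ[ n ∈ C ⇒ D ] IsPushout m f g n
    pushout-stable : ∀ {A B C D} {m : A ⇒ B} {f : A ⇒ C} {g : B ⇒ D} {n : C ⇒ D} →
      M m → IsPushout m f g n → M n
    pullback-along-M : ∀ {B C D} (g : B ⇒ D) (n : C ⇒ D) → M n →
      Σ[ A ∈ Obj ] Σ[ m ∈ A ⇒ B ] Σ[ f ∈ A ⇒ C ] IsPullback g n m f
    pullback-stable : ∀ {A B C D} {g : B ⇒ D} {n : C ⇒ D} {m : A ⇒ B} {f : A ⇒ C} →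
      M n → IsPullback g n m f → M m
    -- pushouts along M are vertical weak van Kampen squares:
    -- bottom face (A,B,C,D) is a pushout with m ∈ M; the cube commutes,
    -- the vertical morphisms b, c, d are in M and the back faces are
    -- pullbacks.
    vanKampen :
      ∀ {A B C D A' B' C' D'}
        {m : A ⇒ B} {f : A ⇒ C} {g : B ⇒ D} {n : C ⇒ D}
        {m' : A' ⇒ B'} {f' : A' ⇒ C'} {g' : B' ⇒ D'} {n' : C' ⇒ D'}
        {a : A' ⇒ A} {b : B' ⇒ B} {c : C' ⇒ C} {d : D' ⇒ D} →
      IsPushout m f g n → M m →
      g' ∘ m' ≡ n' ∘ f' →
      g ∘ b ≡ d ∘ g' → n ∘ c ≡ d ∘ n' →
      M b → M c → M d →
      IsPullback b m m' a → IsPullback c f f' a →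
      (IsPushout m' f' g' n' → IsPullback g d b g' × IsPullback n d c n') ×
      (IsPullback g d b g' × IsPullback n d c n' → IsPushout m' f' g' n')

module Transformations {o ℓ m : Level} (C : Category o ℓ) (MA : MAdhesive C m) where
  open Category C
  open CatDefs C
  open MAdhesive MA

  record Rule : Set (o ⊔ ℓ ⊔ m) where
    field
      L I R : Obj
      l : I ⇒ L
      r : I ⇒ R
      l∈M : M l
      r∈M : M r

  record DirectTransformation (p : Rule) (G : Obj) : Set (o ⊔ ℓ) where
    open Rule p
    field
      match : L ⇒ G
      D H   : Obj
      d     : I ⇒ D
      k     : D ⇒ G
      h     : D ⇒ H
      n     : R ⇒ H
      left  : IsPushout l d match k
      right : IsPushout r d n h

  record TransPair (p₁ p₂ : Rule) : Set (o ⊔ ℓ ⊔ m) where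
    field
      G  : Obj
      t₁ : DirectTransformation p₁ G
      t₂ : DirectTransformation p₂ G

  module _ {p₁ p₂ : Rule} where
    open DirectTransformation

    ParallelIndependent : TransPair p₁ p₂ → Set ℓ
    ParallelIndependent tp =
      (Σ[ d₁₂ ∈ Rule.L p₁ ⇒ D t₂ ] (k t₂ ∘ d₁₂ ≡ match t₁)) ×
      (Σ[ d₂₁ ∈ Rule.L p₂ ⇒ D t₁ ] (k t₁ ∘ d₂₁ ≡ match t₂))
      where open TransPair tp

    Conflict : TransPair p₁ p₂ → Set ℓ
    Conflict tp = ¬ ParallelIndependent tp

  record ExtensionDiagram {p : Rule} {K G : Obj}
      (t' : DirectTransformation p K) (t : DirectTransformation p G) (f : K ⇒ G)
      : Set (o ⊔ ℓ) where
    private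
      module t' = DirectTransformation t'
      module t  = DirectTransformation t
    field
      fD : t'.D ⇒ t.D
      fH : t'.H ⇒ t.H
      match-eq : t.match ≡ f ∘ t'.match
      d-eq     : t.d ≡ fD ∘ t'.d
      n-eq     : t.n ≡ fH ∘ t'.n
      left-po  : IsPushout t'.k fD f t.k
      right-po : IsPushout t'.h fD fH t.h

  record Embedding {p₁ p₂ : Rule} (tp' tp : TransPair p₁ p₂)
      (f : TransPair.G tp' ⇒ TransPair.G tp) : Set (o ⊔ ℓ) where
    field
      ext₁ : ExtensionDiagram (TransPair.t₁ tp') (TransPair.t₁ tp) f
      ext₂ : ExtensionDiagram (TransPair.t₂ tp') (TransPair.t₂ tp) f

  module _ {p₁ p₂ : Rule} where
    open ExtensionDiagram
    open Embedding

    SameDiagrams : {tp' tp : TransPair p₁ p₂} {f g : TransPair.G tp' ⇒ TransPair.G tp} →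
                   Embedding tp' tp f → Embedding tp' tp g → Set ℓ
    SameDiagrams e e' =
      (fD (ext₁ e) ≡ fD (ext₁ e') × fH (ext₁ e) ≡ fH (ext₁ e')) ×
      (fD (ext₂ e) ≡ fD (ext₂ e') × fH (ext₂ e) ≡ fH (ext₂ e'))

    IsInitialFor : TransPair p₁ p₂ → TransPair p₁ p₂ → Set (o ⊔ ℓ ⊔ m)
    IsInitialFor tpI tp =
      Σ[ fI ∈ TransPair.G tpI ⇒ TransPair.G tp ]
        (Embedding tpI tp fI ×
         (∀ (tp' : TransPair p₁ p₂) (f : TransPair.G tp' ⇒ TransPair.G tp) →
            Embedding tp' tp f →
            Σ[ f'I ∈ TransPair.G tpI ⇒ TransPair.G tp' ]
            Σ[ e ∈ Embedding tpI tp' f'I ]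
              ((f ∘ f'I ≡ fI) ×
               (∀ (g : TransPair.G tpI ⇒ TransPair.G tp') (e' : Embedding tpI tp' g) →
                  f ∘ g ≡ fI → (g ≡ f'I × SameDiagrams e' e)))))

    _≅TP_ : TransPair p₁ p₂ → TransPair p₁ p₂ → Set (o ⊔ ℓ)
    tp ≅TP tp' =
      Σ[ f ∈ TransPair.G tp ⇒ TransPair.G tp' ]
      Σ[ e ∈ Embedding tp tp' f ]
        (Iso f × (Iso (fD (ext₁ e)) × Iso (fH (ext₁ e))) ×
                 (Iso (fD (ext₂ e)) × Iso (fH (ext₂ e))))

    IsInitialConflict : TransPair p₁ p₂ → Set (o ⊔ ℓ ⊔ m)
    IsInitialConflict tp =
      Conflict tp × Σ[ tpI ∈ TransPair p₁ p₂ ] (IsInitialFor tpI tp × (tp ≅TP tpI))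

  HasInitialPairsForConflicts : Set (o ⊔ ℓ ⊔ m)
  HasInitialPairsForConflicts =
    ∀ (p₁ p₂ : Rule) (tp : TransPair p₁ p₂) → Conflict tp →
      Σ[ tpI ∈ TransPair p₁ p₂ ] IsInitialFor tpI tp

  module _ (p₁ p₂ : Rule) where

    -- carrier of the set S of initial conflicts; S itself is this type
    -- modulo the equivalence _≅TP_ on first components
    InitialConflicts : Set (o ⊔ ℓ ⊔ m)
    InitialConflicts = Σ[ tp ∈ TransPair p₁ p₂ ] IsInitialConflict tp

    -- a set S' of transformation pairs given as an indexed family F : I → ...
    -- is complete w.r.t. parallel dependence
    CompleteFamily : ∀ {a} {I : Set a} → (I → TransPair p₁ p₂) → Set (o ⊔ ℓ ⊔ m ⊔ a)
    CompleteFamily {I = I} F =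
      ∀ (tp : TransPair p₁ p₂) → Conflict tp →
        Σ[ i ∈ I ] Σ[ f ∈ TransPair.G (F i) ⇒ TransPair.G tp ] Embedding (F i) tp f

    InitialConflictsComplete : Set (o ⊔ ℓ ⊔ m)
    InitialConflictsComplete =
      ∀ (tp : TransPair p₁ p₂) → Conflict tp →
        Σ[ x ∈ InitialConflicts ]
        Σ[ f ∈ TransPair.G (proj₁ x) ⇒ TransPair.G tp ] Embedding (proj₁ x) tp f

    -- |I| ≤ |S|  : an injection of I into the iso-classes of initial conflicts
    _≼S : ∀ {a} (I : Set a) → Set (o ⊔ ℓ ⊔ m ⊔ a)
    I ≼S = Σ[ φ ∈ (I → InitialConflicts) ]
             (∀ i j → proj₁ (φ i) ≅TP proj₁ (φ j) → i ≡ j)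

    -- |S| ≤ |I|  : an injection of the iso-classes of initial conflicts into I
    -- (classically equivalent to the existence of such an injection on
    -- the quotient, by choosing representatives)
    S≼_ : ∀ {a} (I : Set a) → Set (o ⊔ ℓ ⊔ m ⊔ a)
    S≼ I = Σ[ ψ ∈ (InitialConflicts → I) ]
             (∀ x y → ψ x ≡ ψ y → proj₁ x ≅TP proj₁ y)

    _≺S : ∀ {a} (I : Set a) → Set (o ⊔ ℓ ⊔ m ⊔ a)
    I ≺S = (I ≼S) × ¬ (S≼ I)

    MinimallyComplete : (a : Level) → Set (o ⊔ ℓ ⊔ m ⊔ lsuc a)
    MinimallyComplete a =
      InitialConflictsComplete ×
      (∀ (I : Set a) (F : I → TransPair p₁ p₂) →
         (∀ i → Conflict (F i)) → CompleteFamily F → ¬ (I ≺S))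

-- An initial transformation pair is unique up to isomorphism, and it stays
-- initial for every pair embedded into its target.  So if a conflict Q
-- embeds into two initial conflicts, both are isomorphic to the initial
-- pair of Q, hence to each other.  Given any complete family S' of
-- conflicts, sending an initial conflict to a member of S' embedding into
-- it is therefore injective on isomorphism classes, i.e. |S| ≤ |S'|.
-- Completeness of S holds because the initial pair of a conflict is again
-- a conflict: parallel independence extends along embeddings.
module Submission where

open import Defs
open import Level using (Level; _⊔_)
open import Data.Product using (Σ-syntax; _×_; _,_; proj₁; proj₂)
open import Relation.Binary.PropositionalEquality
  using (_≡_; refl; sym; trans; cong; module ≡-Reasoning)

module CategoryLemmas {o ℓ : Level} (C : Category o ℓ) where
  open Category C
  open CatDefs C
  open ≡-Reasoning

  module _ {A B C D} {f : C ⇒ D} {g : B ⇒ C} {h : A ⇒ B} where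

    pullʳ : ∀ {i : A ⇒ C} → g ∘ h ≡ i → (f ∘ g) ∘ h ≡ f ∘ i
    pullʳ e = trans (assoc h g f) (cong (f ∘_) e)

    pullˡ : ∀ {i : B ⇒ D} → f ∘ g ≡ i → f ∘ (g ∘ h) ≡ i ∘ h
    pullˡ e = trans (sym (assoc h g f)) (cong (_∘ h) e)

  cancelʳ : ∀ {A B C} {f : B ⇒ C} {g : A ⇒ B} {h : B ⇒ A} →
            g ∘ h ≡ id → (f ∘ g) ∘ h ≡ f
  cancelʳ {f = f} e = trans (pullʳ e) (identityʳ f)

  cancelˡ : ∀ {A B C} {f : C ⇒ A} {g : A ⇒ B} {h : B ⇒ A} →
            h ∘ g ≡ id → h ∘ (g ∘ f) ≡ f
  cancelˡ {f = f} e = trans (pullˡ e) (identityˡ f)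

  iso-id : ∀ {A} → Iso (id {A})
  iso-id = id , identityˡ id , identityˡ id

  iso-inverse : ∀ {A B} {f : A ⇒ B} (i : Iso f) → Iso (proj₁ i)
  iso-inverse {f = f} (_ , f⁻¹f , ff⁻¹) = f , ff⁻¹ , f⁻¹f

  iso-∘ : ∀ {A B C} {f : A ⇒ B} {g : B ⇒ C} → Iso f → Iso g → Iso (g ∘ f)
  iso-∘ {f = f} {g} (f⁻¹ , f⁻¹f , ff⁻¹) (g⁻¹ , g⁻¹g , gg⁻¹) =
    f⁻¹ ∘ g⁻¹ ,
    trans (pullʳ (cancelˡ g⁻¹g)) f⁻¹f ,
    trans (pullʳ (cancelˡ ff⁻¹)) gg⁻¹

  iso-epi : ∀ {A B C} {g : A ⇒ B} {x y : B ⇒ C} → Iso g → x ∘ g ≡ y ∘ g → x ≡ y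
  iso-epi {g = g} {x} {y} (g⁻¹ , _ , gg⁻¹) e = begin
    x             ≡⟨ sym (cancelʳ gg⁻¹) ⟩
    (x ∘ g) ∘ g⁻¹ ≡⟨ cong (_∘ g⁻¹) e ⟩
    (y ∘ g) ∘ g⁻¹ ≡⟨ cancelʳ gg⁻¹ ⟩
    y             ∎

  iso-transpose : ∀ {A B C} {x : B ⇒ C} {a : A ⇒ C} {b : A ⇒ B} (i : Iso x) →
                  a ≡ x ∘ b → b ≡ proj₁ i ∘ a
  iso-transpose (_ , x⁻¹x , _) e = trans (sym (cancelˡ x⁻¹x)) (cong (_ ∘_) (sym e))

  square-inverse : ∀ {A B C D} {a : A ⇒ B} {x : B ⇒ D} {b : C ⇒ D} {y : A ⇒ C}
                   (i : Iso x) (j : Iso y) →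
                   x ∘ a ≡ b ∘ y → proj₁ i ∘ b ≡ a ∘ proj₁ j
  square-inverse {a = a} {x} {b} {y} (x⁻¹ , x⁻¹x , _) (y⁻¹ , _ , yy⁻¹) sq = begin
    x⁻¹ ∘ b               ≡⟨ sym (cancelʳ yy⁻¹) ⟩
    ((x⁻¹ ∘ b) ∘ y) ∘ y⁻¹ ≡⟨ cong (_∘ y⁻¹) (pullʳ (sym sq)) ⟩
    (x⁻¹ ∘ (x ∘ a)) ∘ y⁻¹ ≡⟨ cong (_∘ y⁻¹) (cancelˡ x⁻¹x) ⟩
    a ∘ y⁻¹               ∎

  isPushout-parallel-isos : ∀ {A B C D} {f : A ⇒ B} {g : A ⇒ C} {g' : B ⇒ D} {f' : C ⇒ D} →
                            Iso g → Iso g' → g' ∘ f ≡ f' ∘ g → IsPushout f g g' f'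
  isPushout-parallel-isos {f = f} {g} {g'} {f'} g-iso g'-iso@(g'⁻¹ , g'⁻¹g' , _) sq =
    sq , λ x y e → x ∘ g'⁻¹ , (cancelʳ g'⁻¹g' , factor-y x y e) ,
                   λ u' u'g' _ → iso-epi g'-iso (trans u'g' (sym (cancelʳ g'⁻¹g')))
    where
    factor-y : ∀ {X} (x : _ ⇒ X) y → x ∘ f ≡ y ∘ g → (x ∘ g'⁻¹) ∘ f' ≡ y
    factor-y x y e = iso-epi g-iso (begin
      ((x ∘ g'⁻¹) ∘ f') ∘ g ≡⟨ pullʳ (sym sq) ⟩
      (x ∘ g'⁻¹) ∘ (g' ∘ f) ≡⟨ pullˡ (cancelʳ g'⁻¹g') ⟩
      x ∘ f                 ≡⟨ e ⟩
      y ∘ g                 ∎)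

  isPushout-paste : ∀ {A B C D E F} {f : A ⇒ B} {g : A ⇒ C} {g' : B ⇒ D} {f' : C ⇒ D}
                      {h : C ⇒ E} {h' : D ⇒ F} {f'' : E ⇒ F} →
                    IsPushout f g g' f' → IsPushout f' h h' f'' →
                    IsPushout f (h ∘ g) (h' ∘ g') f''
  isPushout-paste {f = f} {g} {g'} {f'} {h} {h'} {f''} (sq₁ , univ₁) (sq₂ , univ₂) =
    sq , univ
    where
    sq : (h' ∘ g') ∘ f ≡ f'' ∘ (h ∘ g)
    sq = begin
      (h' ∘ g') ∘ f ≡⟨ pullʳ sq₁ ⟩
      h' ∘ (f' ∘ g) ≡⟨ pullˡ sq₂ ⟩
      (f'' ∘ h) ∘ g ≡⟨ assoc g h f'' ⟩
      f'' ∘ (h ∘ g) ∎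

    univ : ∀ {X} (x : _ ⇒ X) (y : _ ⇒ X) → x ∘ f ≡ y ∘ (h ∘ g) →
      Σ[ u ∈ _ ⇒ X ] ((u ∘ (h' ∘ g') ≡ x × u ∘ f'' ≡ y) ×
                      (∀ u' → u' ∘ (h' ∘ g') ≡ x → u' ∘ f'' ≡ y → u' ≡ u))
    univ x y e
      with univ₁ x (y ∘ h) (trans e (sym (assoc g h y)))
    ... | u₁ , (u₁g' , u₁f') , unique₁
      with univ₂ u₁ y u₁f'
    ... | u₂ , (u₂h' , u₂f'') , unique₂ =
      u₂ , (trans (sym (assoc g' h' u₂)) (trans (cong (_∘ g') u₂h') u₁g') , u₂f'') ,
      λ u' u'x u'y → unique₂ u' (unique₁ (u' ∘ h') (trans (assoc g' h' u') u'x)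
                                   (trans (pullʳ sq₂) (pullˡ u'y))) u'y

module TransformationLemmas {o ℓ m : Level} (C : Category o ℓ) (MA : MAdhesive C m) where
  open Category C
  open CatDefs C
  open CategoryLemmas C
  open Transformations C MA
  open ≡-Reasoning
  open DirectTransformation
  open ExtensionDiagram
  open Embedding
  open TransPair using (G)

  module _ {p : Rule} where

    ext-id : ∀ {X} (t : DirectTransformation p X) → ExtensionDiagram t t id
    ext-id t = record
      { fD = id ; fH = id
      ; match-eq = sym (identityˡ _) ; d-eq = sym (identityˡ _) ; n-eq = sym (identityˡ _)
      ; left-po  = isPushout-parallel-isos iso-id iso-id id-square
      ; right-po = isPushout-parallel-isos iso-id iso-id id-square
      }
      where
      id-square : ∀ {A B} {k : A ⇒ B} → id ∘ k ≡ k ∘ id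
      id-square {k = k} = trans (identityˡ k) (sym (identityʳ k))

    ext-∘ : ∀ {X Y Z} {t : DirectTransformation p X} {u : DirectTransformation p Y}
              {v : DirectTransformation p Z} {f : X ⇒ Y} {g : Y ⇒ Z} →
            ExtensionDiagram t u f → ExtensionDiagram u v g → ExtensionDiagram t v (g ∘ f)
    ext-∘ e₁ e₂ = record
      { fD = fD e₂ ∘ fD e₁ ; fH = fH e₂ ∘ fH e₁
      ; match-eq = compose (match-eq e₂) (match-eq e₁)
      ; d-eq = compose (d-eq e₂) (d-eq e₁)
      ; n-eq = compose (n-eq e₂) (n-eq e₁)
      ; left-po  = isPushout-paste (left-po e₁) (left-po e₂)
      ; right-po = isPushout-paste (right-po e₁) (right-po e₂)
      }
      where
      compose : ∀ {A B C D} {a : A ⇒ D} {b : A ⇒ C} {c : A ⇒ B} {y : C ⇒ D} {x : B ⇒ C} →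
                a ≡ y ∘ b → b ≡ x ∘ c → a ≡ (y ∘ x) ∘ c
      compose {c = c} {y} {x} e₁ e₂ = trans e₁ (trans (cong (y ∘_) e₂) (sym (assoc c x y)))

    ext-inverse : ∀ {X Y} {t : DirectTransformation p X} {u : DirectTransformation p Y}
                    {f : X ⇒ Y} (e : ExtensionDiagram t u f)
                    (f-iso : Iso f) (fD-iso : Iso (fD e)) (fH-iso : Iso (fH e)) →
                  ExtensionDiagram u t (proj₁ f-iso)
    ext-inverse e f-iso fD-iso fH-iso = record
      { fD = proj₁ fD-iso ; fH = proj₁ fH-iso
      ; match-eq = iso-transpose f-iso (match-eq e)
      ; d-eq = iso-transpose fD-iso (d-eq e)
      ; n-eq = iso-transpose fH-iso (n-eq e)
      ; left-po  = isPushout-parallel-isos (iso-inverse fD-iso) (iso-inverse f-iso)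
                     (square-inverse f-iso fD-iso (proj₁ (left-po e)))
      ; right-po = isPushout-parallel-isos (iso-inverse fD-iso) (iso-inverse fH-iso)
                     (square-inverse fH-iso fD-iso (proj₁ (right-po e)))
      }

    ext-lift-match : ∀ {q} {X Y} {s' : DirectTransformation p X} {s : DirectTransformation p Y}
                       {u' : DirectTransformation q X} {u : DirectTransformation q Y} {f : X ⇒ Y}
                       (es : ExtensionDiagram s' s f) (eu : ExtensionDiagram u' u f)
                       {d : Rule.L q ⇒ D s'} →
                     k s' ∘ d ≡ match u' → k s ∘ (fD es ∘ d) ≡ match u
    ext-lift-match {s' = s'} {s} {u'} {u} {f} es eu {d} e = begin
      k s ∘ (fD es ∘ d) ≡⟨ pullˡ (sym (proj₁ (left-po es))) ⟩
      (f ∘ k s') ∘ d    ≡⟨ pullʳ e ⟩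
      f ∘ match u'      ≡⟨ sym (match-eq eu) ⟩
      match u           ∎

  module _ {p₁ p₂ : Rule} where

    _↪_ : TransPair p₁ p₂ → TransPair p₁ p₂ → Set (o ⊔ ℓ)
    tp ↪ tp' = Σ[ f ∈ G tp ⇒ G tp' ] Embedding tp tp' f

    emb-id : (tp : TransPair p₁ p₂) → Embedding tp tp id
    emb-id tp = record { ext₁ = ext-id (TransPair.t₁ tp) ; ext₂ = ext-id (TransPair.t₂ tp) }

    emb-∘ : ∀ {tp tp' tp'' : TransPair p₁ p₂} {f : G tp ⇒ G tp'} {g : G tp' ⇒ G tp''} →
            Embedding tp tp' f → Embedding tp' tp'' g → Embedding tp tp'' (g ∘ f)
    emb-∘ e e' = record { ext₁ = ext-∘ (ext₁ e) (ext₁ e') ; ext₂ = ext-∘ (ext₂ e) (ext₂ e') }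

    ≅TP-refl : ∀ {tp : TransPair p₁ p₂} → tp ≅TP tp
    ≅TP-refl {tp} = id , emb-id tp , iso-id , (iso-id , iso-id) , (iso-id , iso-id)

    ≅TP-sym : ∀ {tp tp' : TransPair p₁ p₂} → tp ≅TP tp' → tp' ≅TP tp
    ≅TP-sym (_ , e , f-iso , (D₁-iso , H₁-iso) , (D₂-iso , H₂-iso)) =
      proj₁ f-iso ,
      record { ext₁ = ext-inverse (ext₁ e) f-iso D₁-iso H₁-iso
             ; ext₂ = ext-inverse (ext₂ e) f-iso D₂-iso H₂-iso } ,
      iso-inverse f-iso ,
      (iso-inverse D₁-iso , iso-inverse H₁-iso) , (iso-inverse D₂-iso , iso-inverse H₂-iso)

    ≅TP-trans : ∀ {tp tp' tp'' : TransPair p₁ p₂} → tp ≅TP tp' → tp' ≅TP tp'' → tp ≅TP tp''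
    ≅TP-trans (_ , e , f-iso , (D₁-iso , H₁-iso) , (D₂-iso , H₂-iso))
              (_ , e' , f'-iso , (D₁'-iso , H₁'-iso) , (D₂'-iso , H₂'-iso)) =
      _ , emb-∘ e e' , iso-∘ f-iso f'-iso ,
      (iso-∘ D₁-iso D₁'-iso , iso-∘ H₁-iso H₁'-iso) , (iso-∘ D₂-iso D₂'-iso , iso-∘ H₂-iso H₂'-iso)

    independent-extend : ∀ {tp' tp : TransPair p₁ p₂} {f : G tp' ⇒ G tp} →
                         Embedding tp' tp f → ParallelIndependent tp' → ParallelIndependent tp
    independent-extend e ((d₁₂ , e₁₂) , (d₂₁ , e₂₁)) =
      (fD (ext₂ e) ∘ d₁₂ , ext-lift-match (ext₂ e) (ext₁ e) e₁₂) ,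
      (fD (ext₁ e) ∘ d₂₁ , ext-lift-match (ext₁ e) (ext₂ e) e₂₁)

    conflict-restrict : ∀ {tp' tp : TransPair p₁ p₂} {f : G tp' ⇒ G tp} →
                        Embedding tp' tp f → Conflict tp → Conflict tp'
    conflict-restrict e conflict independent = conflict (independent-extend e independent)

    initial-restrict : ∀ {tpI tp tp' : TransPair p₁ p₂} {f : G tp' ⇒ G tp} →
                       IsInitialFor tpI tp → Embedding tp' tp f → IsInitialFor tpI tp'
    initial-restrict {tp' = tp'} {f} (fI , eI , univ) e with univ tp' f e
    ... | f'I , e'I , f∘f'I≡fI , unique-f'I =
      f'I , e'I , λ tp'' g eg →
        let f''I , e''I , fg∘f''I≡fI , unique-f''I = univ tp'' (f ∘ g) (emb-∘ eg e)
        in f''I , e''I ,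
           proj₁ (unique-f'I (g ∘ f''I) (emb-∘ e''I eg)
                             (trans (sym (assoc f''I g f)) fg∘f''I≡fI)) ,
           λ h eh g∘h≡f'I → unique-f''I h eh (trans (pullʳ g∘h≡f'I) f∘f'I≡fI)

    initial-endo-trivial : ∀ {tpI tp : TransPair p₁ p₂} (initial : IsInitialFor tpI tp)
                           {g : G tpI ⇒ G tpI} (e : Embedding tpI tpI g) →
                           proj₁ initial ∘ g ≡ proj₁ initial →
                           g ≡ id × SameDiagrams e (emb-id tpI)
    initial-endo-trivial {tpI} (fI , eI , univ) e fI∘g≡fI
      with univ tpI fI eI
    ... | _ , _ , _ , unique
      with unique id (emb-id tpI) (identityʳ fI) | unique _ e fI∘g≡fI
    ... | id≡ , (D₁-id , H₁-id) , (D₂-id , H₂-id) | g≡ , (D₁-g , H₁-g) , (D₂-g , H₂-g) =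
      trans g≡ (sym id≡) ,
      (trans D₁-g (sym D₁-id) , trans H₁-g (sym H₁-id)) ,
      (trans D₂-g (sym D₂-id) , trans H₂-g (sym H₂-id))

    initial-unique : ∀ {tpI tpJ tp : TransPair p₁ p₂} →
                     IsInitialFor tpI tp → IsInitialFor tpJ tp → tpI ≅TP tpJ
    initial-unique {tpI} {tpJ} initialI@(fI , eI , univI) initialJ@(fJ , eJ , univJ)
      with univI tpJ fJ eJ | univJ tpI fI eI
    ... | a , ea , fJ∘a≡fI , _ | b , eb , fI∘b≡fJ , _
      with initial-endo-trivial initialI (emb-∘ ea eb)
             (trans (pullˡ fI∘b≡fJ) fJ∘a≡fI)
         | initial-endo-trivial initialJ (emb-∘ eb ea)
             (trans (pullˡ fJ∘a≡fI) fI∘b≡fJ)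
    ... | ba≡id , (D₁-ba , H₁-ba) , (D₂-ba , H₂-ba) | ab≡id , (D₁-ab , H₁-ab) , (D₂-ab , H₂-ab) =
      a , ea , (b , ba≡id , ab≡id) ,
      ((_ , D₁-ba , D₁-ab) , (_ , H₁-ba , H₁-ab)) , ((_ , D₂-ba , D₂-ab) , (_ , H₂-ba , H₂-ab))

    initialPair-isInitialConflict : ∀ {tpI tp : TransPair p₁ p₂} →
                                    Conflict tp → IsInitialFor tpI tp → IsInitialConflict tpI
    initialPair-isInitialConflict {tpI} conflict initial@(fI , eI , _) =
      conflict-restrict eI conflict , tpI , initial-restrict initial eI , ≅TP-refl

    initialConflicts-≅-of-common-source : ∀ {tp} ((x , _) (y , _) : InitialConflicts p₁ p₂) →
                                          tp ↪ x → tp ↪ y → x ≅TP y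
    initialConflicts-≅-of-common-source (_ , _ , _ , initialX , x≅I) (_ , _ , _ , initialY , y≅J)
                                        (_ , ef) (_ , eg) =
      ≅TP-trans x≅I (≅TP-trans (initial-unique (initial-restrict initialX ef)
                                               (initial-restrict initialY eg))
                               (≅TP-sym y≅J))

  module _ (hasInitial : HasInitialPairsForConflicts) (p₁ p₂ : Rule) where

    initialConflicts-complete : InitialConflictsComplete p₁ p₂
    initialConflicts-complete tp conflict with hasInitial p₁ p₂ tp conflict
    ... | tpI , initial@(fI , eI , _) =
      (tpI , initialPair-isInitialConflict conflict initial) , fI , eI

  module _ {p₁ p₂ : Rule} where

    S≼-complete : ∀ {a} {I : Set a} (F : I → TransPair p₁ p₂) →
                  CompleteFamily p₁ p₂ F → S≼_ p₁ p₂ I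
    S≼-complete {I = I} F complete = index , index-injective
      where
      member : (x : InitialConflicts p₁ p₂) → Σ[ i ∈ I ] F i ↪ proj₁ x
      member (x , conflict , _) = complete x conflict

      index : InitialConflicts p₁ p₂ → I
      index x = proj₁ (member x)

      same-member-≅ : ∀ {i j} (x y : InitialConflicts p₁ p₂) →
                      i ≡ j → F i ↪ proj₁ x → F j ↪ proj₁ y → proj₁ x ≅TP proj₁ y
      same-member-≅ x y refl = initialConflicts-≅-of-common-source x y

      index-injective : ∀ x y → index x ≡ index y → proj₁ x ≅TP proj₁ y
      index-injective x y same-index =
        same-member-≅ x y same-index (proj₂ (member x)) (proj₂ (member y))

corollary1 : ∀ {o ℓ m a : Level} (C : Category o ℓ) (MA : MAdhesive C m) →
    Transformations.HasInitialPairsForConflicts C MA →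
    (p₁ p₂ : Transformations.Rule C MA) →
    Transformations.MinimallyComplete C MA p₁ p₂ a
corollary1 C MA hasInitial p₁ p₂ =
  initialConflicts-complete hasInitial p₁ p₂ ,
  λ _ F _ complete (_ , ¬S≼) → ¬S≼ (S≼-complete F complete)
  where open TransformationLemmas C MA
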